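{- Let $M$ be a $\lambda$-term. The following statements are equivalent: (i) there exists $a\in T_r(M)$ such that $NF(a)\neq 0$; (ii) there exist $a\in T_r(M)$ and $m\in\mathbb N$ such that $H_r^m(a)$ is a rigid head-normal form different from $0$; (iii) there exists $m\in\mathbb N$ such that $H^m(M)$ is a head-normal form; (iv) $M$ is head-normalizable, i.e. there is a finite $\beta$-reduction sequence $M=M_0\to_\beta M_1\to_\beta\cdots\to_\beta M_n$ with $M_n$ a head-normal form.
   Context: Rigid resource calculus. Fix a set of variables. Rigid resource terms are given by $a ::= x\mid \lambda x.a\mid \langle c\rangle\vec d\mid 0$, where $\vec d=(d_1,\dots,d_n)$, $n\ge 0$, is a finite list (rigid monomial) of rigid terms; terms are up to $\alpha$-equivalence. $0$ is absorbing: $\lambda x.0=0$, $\langle 0\rangle\vec d=0$, and a list containing $0$ (hence any application to it) equals $0$. For a term $a$ and list $\vec b=(b_1,\dots,b_k)$, the rigid substitution $a[\vec b/x]$ is: if the number of free occurrences of $x$ in $a$ equals $k$, the term obtained by replacing (capture-avoidingly) the $i$-th free occurrence of $x$ in left-to-right order by $b_i$; otherwise $0$. Rigid reduction $\to_r$ is the contextual closure of $\langle\lambda x.a\rangle\vec b\to_r a[\vec b/x]$; it is confluent and strongly normalizing and $NF(a)$ denotes the unique normal form of $a$ (a rigid term or $0$). Rigid expansion of a $\lambda$-term: $T_r(x)=\{x\}$, $T_r(\lambda x.M)=\{\lambda x.a\mid a\in T_r(M)\}$, $T_r(PQ)=\{\langle c\rangle(d_1,\dots,d_n)\mid c\in T_r(P),\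 n\ge0,\ d_i\in T_r(Q)\}$. Every nonzero rigid term has the form $\lambda x_1\dots\lambda x_m.\langle\cdots\langle a'\rangle\vec b_1\cdots\rangle\vec b_n$ with $a'$ a variable or a redex $\langle\lambda x.c\rangle\vec d$; it is a rigid head-normal form if $a'$ is a variable; $0$ is also a head-normal form. The head resource reduction $H_r$ maps a head-normal form to itself and otherwise maps $\lambda x_1\dots\lambda x_m.\langle\cdots\langle\langle\lambda x.c\rangle\vec d\rangle\vec d_1\cdots\rangle\vec d_n$ to $\lambda x_1\dots\lambda x_m.\langle\cdots\langle c[\vec d/x]\rangle\vec d_1\cdots\rangle\vec d_n$. For $\lambda$-terms: $M$ is a head-normal form if $M=\lambda x_1\dots\lambda x_m.yN_1\dots N_n$ with $y$ a variable; $H(M)=M$ if $M$ is a head-normal form, and $H(\lambda x_1\dots\lambda x_m.(\lambda x.P)QQ_1\dots Q_n)=\lambda x_1\dots\lambda x_m.P[Q/x]Q_1\dots Q_n$. -}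

module Defs where

open import Data.Nat using (ℕ; zero; suc; pred; _+_; _<ᵇ_; _≡ᵇ_)
open import Data.Bool using (if_then_else_)
open import Data.List using (List; []; _∷_)
open import Data.List.Relation.Unary.All using (All)
open import Data.Maybe using (Maybe; just; nothing)
import Data.Maybe as Maybe
open import Data.Product using (_×_; _,_)
open import Relation.Nullary using (¬_)
open import Relation.Binary.Construct.Closure.ReflexiveTransitive using (Star)
open import Data.Unit using (⊤)

_^[_]_ : {A : Set} → (A → A) → ℕ → A → A
f ^[ zero ] x = x
f ^[ suc m ] x = f (f ^[ m ] x)

-- λ-terms (de Bruijn indices, so α-equivalence is syntactic equality)

data Λ : Set where
  var : ℕ → Λ
  lam : Λ → Λ
  app : Λ → Λ → Λ

shiftΛ : ℕ → ℕ → Λ → Λ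
shiftΛ c d (var n) = if n <ᵇ c then var n else var (n + d)
shiftΛ c d (lam M) = lam (shiftΛ (suc c) d M)
shiftΛ c d (app M N) = app (shiftΛ c d M) (shiftΛ c d N)

-- substΛ k N M : substitute N for index k in M (removing binder k)
substΛ : ℕ → Λ → Λ → Λ
substΛ k N (var n) =
  if n <ᵇ k then var n else (if n ≡ᵇ k then shiftΛ 0 k N else var (pred n))
substΛ k N (lam M) = lam (substΛ (suc k) N M)
substΛ k N (app M P) = app (substΛ k N M) (substΛ k N P)

_[_/0] : Λ → Λ → Λ
M [ N /0] = substΛ 0 N M

data _→β_ : Λ → Λ → Set where
  β    : ∀ {P Q} → app (lam P) Q →β (P [ Q /0])
  ξλ   : ∀ {M M'} → M →β M' → lam M →β lam M'
  ξappˡ  : ∀ {M M' N} → M →β M' → app M N →β app M' N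
  ξappʳ  : ∀ {M N N'} → N →β N' → app M N →β app M N'

_→β*_ : Λ → Λ → Set
_→β*_ = Star _→β_

data HeadVarΛ : Λ → Set where
  var : ∀ {n} → HeadVarΛ (var n)
  app : ∀ {M N} → HeadVarΛ M → HeadVarΛ (app M N)

data IsHNF : Λ → Set where
  head : ∀ {M} → HeadVarΛ M → IsHNF M
  lam  : ∀ {M} → IsHNF M → IsHNF (lam M)

-- head reduction H (identity on head-normal forms)
H : Λ → Λ
H (var n) = var n
H (lam M) = lam (H M)
H (app (lam P) Q) = P [ Q /0]
H (app (var n) Q) = app (var n) Q
H (app (app M N) Q) = app (H (app M N)) Q

-- Rigid resource terms.  0 is absorbing, so a "rigid term or 0" is
-- represented as  Maybe RT  with  nothing = 0, and RT contains no 0.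

data RT : Set where
  var : ℕ → RT
  lam : RT → RT
  app : RT → List RT → RT     -- ⟨ c ⟩ (d1,...,dn)

mutual
  shiftR : ℕ → ℕ → RT → RT
  shiftR c d (var n) = if n <ᵇ c then var n else var (n + d)
  shiftR c d (lam a) = lam (shiftR (suc c) d a)
  shiftR c d (app a ds) = app (shiftR c d a) (shiftRL c d ds)

  shiftRL : ℕ → ℕ → List RT → List RT
  shiftRL c d [] = []
  shiftRL c d (a ∷ as) = shiftR c d a ∷ shiftRL c d as

-- rsub k a bs : replaces the free occurrences of index k in a, in
-- left-to-right order, by the successive elements of bs; returns the
-- remaining (unused) elements, or nothing if bs runs out.
rsubVar : ℕ → ℕ → List RT → Maybe (RT × List RT)
rsubVar k n bs with n <ᵇ k | n ≡ᵇ k | bs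
... | Data.Bool.true  | _               | _        = just (var n , bs)
... | Data.Bool.false | Data.Bool.true  | []       = nothing
... | Data.Bool.false | Data.Bool.true  | b ∷ bs'  = just (shiftR 0 k b , bs')
... | Data.Bool.false | Data.Bool.false | _        = just (var (pred n) , bs)

mutual
  rsub : ℕ → RT → List RT → Maybe (RT × List RT)
  rsub k (var n) bs = rsubVar k n bs
  rsub k (lam a) bs with rsub (suc k) a bs
  ... | nothing = nothing
  ... | just (a' , bs') = just (lam a' , bs')
  rsub k (app c ds) bs with rsub k c bs
  ... | nothing = nothing
  ... | just (c' , bs₁) with rsubL k ds bs₁
  ...   | nothing = nothing
  ...   | just (ds' , bs₂) = just (app c' ds' , bs₂)

  rsubL : ℕ → List RT → List RT → Maybe (List RT × List RT)
  rsubL k [] bs = just ([] , bs)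
  rsubL k (d ∷ ds) bs with rsub k d bs
  ... | nothing = nothing
  ... | just (d' , bs₁) with rsubL k ds bs₁
  ...   | nothing = nothing
  ...   | just (ds' , bs₂) = just (d' ∷ ds' , bs₂)

-- rigid substitution  c [ bs / x ]  for the outermost bound variable x
-- of the body c: 0 (nothing) unless #occurrences of x = length bs.
rsubst : RT → List RT → Maybe RT
rsubst c bs with rsub 0 c bs
... | just (c' , []) = just c'
... | _ = nothing

mutual
  data _→r_ : RT → Maybe RT → Set where
    β     : ∀ {c ds} → app (lam c) ds →r rsubst c ds
    ξλ    : ∀ {a r} → a →r r → lam a →r Maybe.map lam r
    ξappˡ   : ∀ {c r ds} → c →r r → app c ds →r Maybe.map (λ c' → app c' ds) r
    ξappʳ   : ∀ {c ds rs} → ds →rL rs → app c ds →r Maybe.map (app c) rs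

  data _→rL_ : List RT → Maybe (List RT) → Set where
    here  : ∀ {d r ds} → d →r r → (d ∷ ds) →rL Maybe.map (_∷ ds) r
    there : ∀ {d ds rs} → ds →rL rs → (d ∷ ds) →rL Maybe.map (d ∷_) rs

data _→r*_ : Maybe RT → Maybe RT → Set where
  refl : ∀ {r} → r →r* r
  step : ∀ {a r s} → a →r r → r →r* s → just a →r* s

Normal : Maybe RT → Set
Normal nothing = ⊤
Normal (just a) = ∀ r → ¬ (a →r r)

IsNF : RT → Maybe RT → Set
IsNF a n = (just a →r* n) × Normal n

data _∈Tr_ : RT → Λ → Set where
  var : ∀ {x} → var x ∈Tr var x
  lam : ∀ {a M} → a ∈Tr M → lam a ∈Tr lam M
  app : ∀ {c ds P Q} → c ∈Tr P → All (_∈Tr Q) ds → app c ds ∈Tr app P Q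

data HeadVarR : RT → Set where
  var : ∀ {n} → HeadVarR (var n)
  app : ∀ {c ds} → HeadVarR c → HeadVarR (app c ds)

data IsHNFr : RT → Set where
  head : ∀ {a} → HeadVarR a → IsHNFr a
  lam  : ∀ {a} → IsHNFr a → IsHNFr (lam a)

Hr₀ : RT → Maybe RT
Hr₀ (var n) = just (var n)
Hr₀ (lam a) = Maybe.map lam (Hr₀ a)
Hr₀ (app (lam c) ds) = rsubst c ds
Hr₀ (app (var n) ds) = just (app (var n) ds)
Hr₀ (app (app c es) ds) = Maybe.map (λ c' → app c' ds) (Hr₀ (app c es))

Hr : Maybe RT → Maybe RT
Hr nothing = nothing
Hr (just a) = Hr₀ a

module Submission where

-- Proof strategy: (i),(ii) ⇒ (iv) ⇒ (iii) ⇒ (i),(ii), and (iii) ⇒ (iv).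
-- * Soundness.  a ⊑ M (a approximates M) if M β-reduces to a term with the
--   outermost constructor of a, whose subterms the subterms of a again
--   approximate.  T_r(M) ⊆ ⊑, rigid substitution is simulated by β, so the
--   nonzero rigid reducts of a ∈ T_r(M) (its normal form, its H_r-iterates)
--   approximate M; a head-normal approximant gives a head-normal β-reduct.
-- * Standardisation (Takahashi).  β-steps factor through a relation ⇛
--   ("head steps, then recurse into subterms") that commutes with head
--   reduction, so a head-normalisable term is head-normalised by H.
-- * Completeness.  Anti-substitution: each b ∈ T_r(H M) is H_r(a), a ∈ T_r(M).
--   A head-normal form has a rigid-normal "thin" expansion (argument lists
--   all empty); pulling it back along H^m gives a ∈ T_r(M) whose H_r^m is
--   that thin form.

open import Defs
open import Data.Nat using (ℕ)
open import Data.Maybe using (Maybe; just; nothing)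
open import Data.Product using (Σ; _×_)
open import Function.Bundles using (_⇔_)
open import Relation.Binary.PropositionalEquality using (_≢_; _≡_)

open import Data.Bool using (true; false)
open import Data.Empty using (⊥; ⊥-elim)
open import Data.List using (List; []; _∷_; _++_)
import Data.List.Properties as List
open import Data.List.Relation.Unary.All using (All; []; _∷_)
import Data.List.Relation.Unary.All.Properties as All
import Data.Maybe as Maybe
open import Data.Nat using (zero; suc; pred; _+_; _<ᵇ_; _≡ᵇ_; _<_; _≤_; z≤n; s≤s; s≤s⁻¹)
open import Data.Nat.Properties
open import Algebra.Properties.CommutativeSemigroup +-commutativeSemigroup using (xy∙z≈xz∙y)
open import Data.Product using (_,_; proj₁; proj₂)
open import Data.Sum using (_⊎_; inj₁; inj₂)
open import Data.Unit using (⊤; tt)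
open import Function.Base using (_∘_)
open import Function.Bundles using (mk⇔)
open import Relation.Binary using (tri<; tri≈; tri>)
open import Relation.Binary.Construct.Closure.ReflexiveTransitive using (Star; ε; _◅_; _◅◅_; gmap)
open import Relation.Binary.PropositionalEquality using (refl; sym; trans; cong; cong₂; subst)
open import Relation.Nullary using (¬_; yes; no)

<ᵇ-true : ∀ {n c} → n < c → (n <ᵇ c) ≡ true
<ᵇ-true {n} {c} n<c with n <ᵇ c | <⇒<ᵇ n<c
... | true | _ = refl

<ᵇ-false : ∀ {n c} → c ≤ n → (n <ᵇ c) ≡ false
<ᵇ-false {n} {c} c≤n with n <ᵇ c | <ᵇ⇒< n c
... | false | _   = refl
... | true  | n<c = ⊥-elim (<⇒≱ (n<c tt) c≤n)

≡ᵇ-true : ∀ n → (n ≡ᵇ n) ≡ true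
≡ᵇ-true n with n ≡ᵇ n | ≡⇒≡ᵇ n n refl
... | true | _ = refl

≡ᵇ-false : ∀ {m n} → m ≢ n → (m ≡ᵇ n) ≡ false
≡ᵇ-false {m} {n} m≢n with m ≡ᵇ n | ≡ᵇ⇒≡ m n
... | false | _   = refl
... | true  | m≡n = ⊥-elim (m≢n (m≡n tt))

shiftΛ-< : ∀ {c d n} → n < c → shiftΛ c d (var n) ≡ var n
shiftΛ-< n<c rewrite <ᵇ-true n<c = refl

shiftΛ-≥ : ∀ {c d n} → c ≤ n → shiftΛ c d (var n) ≡ var (n + d)
shiftΛ-≥ c≤n rewrite <ᵇ-false c≤n = refl

shiftR-< : ∀ {c d n} → n < c → shiftR c d (var n) ≡ var n
shiftR-< n<c rewrite <ᵇ-true n<c = refl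

shiftR-≥ : ∀ {c d n} → c ≤ n → shiftR c d (var n) ≡ var (n + d)
shiftR-≥ c≤n rewrite <ᵇ-false c≤n = refl

substΛ-< : ∀ {k N n} → n < k → substΛ k N (var n) ≡ var n
substΛ-< n<k rewrite <ᵇ-true n<k = refl

substΛ-≡ : ∀ {k N} → substΛ k N (var k) ≡ shiftΛ 0 k N
substΛ-≡ {k} rewrite <ᵇ-false (≤-refl {k}) | ≡ᵇ-true k = refl

substΛ-> : ∀ {k N n} → k < n → substΛ k N (var n) ≡ var (pred n)
substΛ-> k<n rewrite <ᵇ-false (<⇒≤ k<n) | ≡ᵇ-false (>⇒≢ k<n) = refl

rsubVar-< : ∀ {k n bs} → n < k → rsubVar k n bs ≡ just (var n , bs)
rsubVar-< n<k rewrite <ᵇ-true n<k = refl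

rsubVar-≡ : ∀ {k b bs} → rsubVar k k (b ∷ bs) ≡ just (shiftR 0 k b , bs)
rsubVar-≡ {k} rewrite <ᵇ-false (≤-refl {k}) | ≡ᵇ-true k = refl

rsubVar-≡[] : ∀ {k} → rsubVar k k [] ≡ nothing
rsubVar-≡[] {k} rewrite <ᵇ-false (≤-refl {k}) | ≡ᵇ-true k = refl

rsubVar-> : ∀ {k n bs} → k < n → rsubVar k n bs ≡ just (var (pred n) , bs)
rsubVar-> k<n rewrite <ᵇ-false (<⇒≤ k<n) | ≡ᵇ-false (>⇒≢ k<n) = refl

shift-shift-comm : ∀ k d (Q : Λ) c' c → c' ≤ c →
                   shiftΛ (k + c) d (shiftΛ c' k Q) ≡ shiftΛ c' k (shiftΛ c d Q)
shift-shift-comm k d (var n) c' c c'≤c with n <? c'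
... | yes n<c' rewrite shiftΛ-< {c'} {k} n<c'
                     | shiftΛ-< {k + c} {d} (<-≤-trans n<c' (≤-trans c'≤c (m≤n+m c k)))
                     | shiftΛ-< {c} {d} (<-≤-trans n<c' c'≤c) | shiftΛ-< {c'} {k} n<c' = refl
... | no n≮c' with n <? c
...   | yes n<c rewrite shiftΛ-≥ {c'} {k} (≮⇒≥ n≮c')
                      | shiftΛ-< {k + c} {d} (subst (n + k <_) (+-comm c k) (+-monoˡ-< k n<c))
                      | shiftΛ-< {c} {d} n<c | shiftΛ-≥ {c'} {k} (≮⇒≥ n≮c') = refl
...   | no n≮c rewrite shiftΛ-≥ {c'} {k} (≮⇒≥ n≮c')
                     | shiftΛ-≥ {k + c} {d} (subst (_≤ n + k) (+-comm c k) (+-monoˡ-≤ k (≮⇒≥ n≮c)))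
                     | shiftΛ-≥ {c} {d} (≮⇒≥ n≮c)
                     | shiftΛ-≥ {c'} {k} (≤-trans (≮⇒≥ n≮c') (m≤m+n n d)) = cong var (xy∙z≈xz∙y n k d)
shift-shift-comm k d (lam Q) c' c c'≤c rewrite sym (+-suc k c) =
  cong lam (shift-shift-comm k d Q (suc c') (suc c) (s≤s c'≤c))
shift-shift-comm k d (app Q R) c' c c'≤c =
  cong₂ app (shift-shift-comm k d Q c' c c'≤c) (shift-shift-comm k d R c' c c'≤c)

shift-shift-fuse : ∀ k i (Q : Λ) c' c → c' ≤ c → c ≤ c' + k →
                   shiftΛ c i (shiftΛ c' k Q) ≡ shiftΛ c' (k + i) Q
shift-shift-fuse k i (var n) c' c c'≤c c≤c'+k with n <? c'
... | yes n<c' rewrite shiftΛ-< {c'} {k} n<c' | shiftΛ-< {c} {i} (<-≤-trans n<c' c'≤c)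
                     | shiftΛ-< {c'} {k + i} n<c' = refl
... | no n≮c' rewrite shiftΛ-≥ {c'} {k} (≮⇒≥ n≮c')
                    | shiftΛ-≥ {c} {i} (≤-trans c≤c'+k (+-monoˡ-≤ k (≮⇒≥ n≮c')))
                    | shiftΛ-≥ {c'} {k + i} (≮⇒≥ n≮c') = cong var (+-assoc n k i)
shift-shift-fuse k i (lam Q) c' c c'≤c c≤c'+k =
  cong lam (shift-shift-fuse k i Q (suc c') (suc c) (s≤s c'≤c) (s≤s c≤c'+k))
shift-shift-fuse k i (app Q R) c' c c'≤c c≤c'+k =
  cong₂ app (shift-shift-fuse k i Q c' c c'≤c c≤c'+k) (shift-shift-fuse k i R c' c c'≤c c≤c'+k)

subst-shift-cancel : ∀ i (R : Λ) d (Q : Λ) c → c ≤ i → i ≤ c + d →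
                     substΛ i R (shiftΛ c (suc d) Q) ≡ shiftΛ c d Q
subst-shift-cancel i R d (var n) c c≤i i≤c+d with n <? c
... | yes n<c rewrite shiftΛ-< {c} {suc d} n<c | substΛ-< {i} {R} (<-≤-trans n<c c≤i)
                    | shiftΛ-< {c} {d} n<c = refl
... | no n≮c rewrite shiftΛ-≥ {c} {suc d} (≮⇒≥ n≮c) | shiftΛ-≥ {c} {d} (≮⇒≥ n≮c)
                   | substΛ-> {i} {R} {n + suc d}
                       (subst (i <_) (sym (+-suc n d)) (s≤s (≤-trans i≤c+d (+-monoˡ-≤ d (≮⇒≥ n≮c)))))
                   | +-suc n d = refl
subst-shift-cancel i R d (lam Q) c c≤i i≤c+d =
  cong lam (subst-shift-cancel (suc i) R d Q (suc c) (s≤s c≤i) (s≤s i≤c+d))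
subst-shift-cancel i R d (app Q P) c c≤i i≤c+d =
  cong₂ app (subst-shift-cancel i R d Q c c≤i i≤c+d) (subst-shift-cancel i R d P c c≤i i≤c+d)

shift-subst-comm : ∀ k c d (Q P : Λ) →
                   shiftΛ (k + c) d (substΛ k Q P) ≡ substΛ k (shiftΛ c d Q) (shiftΛ (suc (k + c)) d P)
shift-subst-comm k c d Q (var n) with <-cmp n k
... | tri< n<k _ _ rewrite substΛ-< {k} {Q} n<k | shiftΛ-< {k + c} {d} (<-≤-trans n<k (m≤m+n k c))
                         | shiftΛ-< {suc (k + c)} {d} (<-≤-trans n<k (m≤n⇒m≤1+n (m≤m+n k c)))
                         | substΛ-< {k} {shiftΛ c d Q} n<k = refl
... | tri≈ _ refl _ rewrite substΛ-≡ {n} {Q} | shiftΛ-< {suc (n + c)} {d} (s≤s (m≤m+n n c))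
                          | substΛ-≡ {n} {shiftΛ c d Q} = shift-shift-comm n d Q 0 c z≤n
shift-subst-comm k c d Q (var (suc n)) | tri> _ _ k<1+n with n <? k + c
... | yes n<k+c rewrite substΛ-> {k} {Q} k<1+n | shiftΛ-< {k + c} {d} n<k+c
                      | shiftΛ-< {suc (k + c)} {d} (s≤s n<k+c) | substΛ-> {k} {shiftΛ c d Q} k<1+n = refl
... | no n≮k+c rewrite substΛ-> {k} {Q} k<1+n | shiftΛ-≥ {k + c} {d} (≮⇒≥ n≮k+c)
                     | shiftΛ-≥ {suc (k + c)} {d} (s≤s (≮⇒≥ n≮k+c))
                     | substΛ-> {k} {shiftΛ c d Q} {suc n + d} (<-≤-trans k<1+n (m≤m+n (suc n) d)) = refl
shift-subst-comm k c d Q (lam P) = cong lam (shift-subst-comm (suc k) c d Q P)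
shift-subst-comm k c d Q (app P R) = cong₂ app (shift-subst-comm k c d Q P) (shift-subst-comm k c d Q R)

subst-shift-comm : ∀ i (Q R : Λ) c k → c ≤ k →
                   substΛ (k + i) Q (shiftΛ c i R) ≡ shiftΛ c i (substΛ k Q R)
subst-shift-comm i Q (var n) c k c≤k with n <? c
... | yes n<c rewrite shiftΛ-< {c} {i} n<c | substΛ-< {k + i} {Q} (<-≤-trans n<c (≤-trans c≤k (m≤m+n k i)))
                    | substΛ-< {k} {Q} (<-≤-trans n<c c≤k) | shiftΛ-< {c} {i} n<c = refl
... | no n≮c with <-cmp n k
...   | tri< n<k _ _ rewrite shiftΛ-≥ {c} {i} (≮⇒≥ n≮c) | substΛ-< {k + i} {Q} (+-monoˡ-< i n<k)
                           | substΛ-< {k} {Q} n<k | shiftΛ-≥ {c} {i} (≮⇒≥ n≮c) = refl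
...   | tri≈ _ refl _ rewrite shiftΛ-≥ {c} {i} (≮⇒≥ n≮c) | substΛ-≡ {n + i} {Q} | substΛ-≡ {n} {Q} =
  sym (shift-shift-fuse n i Q 0 c z≤n (≮⇒≥ n≮c))
subst-shift-comm i Q (var (suc n)) c k c≤k | no n≮c | tri> _ _ k<1+n
  rewrite shiftΛ-≥ {c} {i} (≮⇒≥ n≮c) | substΛ-> {k + i} {Q} {suc n + i} (+-monoˡ-< i k<1+n)
        | substΛ-> {k} {Q} k<1+n | shiftΛ-≥ {c} {i} (≤-trans c≤k (s≤s⁻¹ k<1+n)) = refl
subst-shift-comm i Q (lam R) c k c≤k = cong lam (subst-shift-comm i Q R (suc c) (suc k) (s≤s c≤k))
subst-shift-comm i Q (app R P) c k c≤k = cong₂ app (subst-shift-comm i Q R c k c≤k) (subst-shift-comm i Q P c k c≤k)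

subst-subst-comm : ∀ i k (Q R P : Λ) →
                   substΛ (i + k) Q (substΛ i R P) ≡ substΛ i (substΛ k Q R) (substΛ (suc (i + k)) Q P)
subst-subst-comm i k Q R (var n) with <-cmp n i
... | tri< n<i _ _ rewrite substΛ-< {i} {R} n<i | substΛ-< {i + k} {Q} (<-≤-trans n<i (m≤m+n i k))
                         | substΛ-< {suc (i + k)} {Q} (<-≤-trans n<i (m≤n⇒m≤1+n (m≤m+n i k)))
                         | substΛ-< {i} {substΛ k Q R} n<i = refl
... | tri≈ _ refl _ rewrite substΛ-≡ {n} {R} | substΛ-< {suc (n + k)} {Q} (s≤s (m≤m+n n k))
                          | substΛ-≡ {n} {substΛ k Q R} =
  trans (cong (λ j → substΛ j Q (shiftΛ 0 n R)) (+-comm n k)) (subst-shift-comm n Q R 0 k z≤n)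
subst-subst-comm i k Q R (var (suc n)) | tri> _ _ i<1+n with <-cmp n (i + k)
... | tri< n<i+k _ _ rewrite substΛ-> {i} {R} i<1+n | substΛ-< {i + k} {Q} n<i+k
                           | substΛ-< {suc (i + k)} {Q} (s≤s n<i+k) | substΛ-> {i} {substΛ k Q R} i<1+n = refl
... | tri≈ _ refl _ rewrite substΛ-> {i} {R} i<1+n | substΛ-≡ {i + k} {Q} | substΛ-≡ {suc (i + k)} {Q} =
  sym (subst-shift-cancel i (substΛ k Q R) (i + k) Q 0 z≤n (m≤m+n i k))
subst-subst-comm i k Q R (var (suc (suc n))) | tri> _ _ i<2+n | tri> _ _ i+k<1+n
  rewrite substΛ-> {i} {R} i<2+n | substΛ-> {i + k} {Q} {suc n} i+k<1+n
        | substΛ-> {suc (i + k)} {Q} {suc (suc n)} (s≤s i+k<1+n)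
        | substΛ-> {i} {substΛ k Q R} {suc n} (≤-<-trans (m≤m+n i k) i+k<1+n) = refl
subst-subst-comm i k Q R (lam P) = cong lam (subst-subst-comm (suc i) k Q R P)
subst-subst-comm i k Q R (app P P') = cong₂ app (subst-subst-comm i k Q R P) (subst-subst-comm i k Q R P')

-- An
-- application only reduces in its function part when that part is not an
-- abstraction (otherwise the whole application is the head redex).

NotLam : Λ → Set
NotLam (lam _) = ⊥
NotLam _       = ⊤

data _→h_ : Λ → Λ → Set where
  hβ   : ∀ {P Q} → app (lam P) Q →h (P [ Q /0])
  hλ   : ∀ {M M'} → M →h M' → lam M →h lam M'
  happ : ∀ {M M' N} → NotLam M → M →h M' → app M N →h app M' N

_→h*_ : Λ → Λ → Set
_→h*_ = Star _→h_

β-shift : ∀ {c d M M'} → M →β M' → shiftΛ c d M →β shiftΛ c d M'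
β-shift {c} {d} (β {P} {Q}) =
  subst (app (lam (shiftΛ (suc c) d P)) (shiftΛ c d Q) →β_) (sym (shift-subst-comm 0 c d Q P)) β
β-shift (ξλ s)    = ξλ (β-shift s)
β-shift (ξappˡ s) = ξappˡ (β-shift s)
β-shift (ξappʳ s) = ξappʳ (β-shift s)

β-subst : ∀ {k N M M'} → M →β M' → substΛ k N M →β substΛ k N M'
β-subst {k} {N} (β {P} {Q}) =
  subst (app (lam (substΛ (suc k) N P)) (substΛ k N Q) →β_) (sym (subst-subst-comm 0 k N Q P)) β
β-subst (ξλ s)    = ξλ (β-subst s)
β-subst (ξappˡ s) = ξappˡ (β-subst s)
β-subst (ξappʳ s) = ξappʳ (β-subst s)

h-shift : ∀ {c d M M'} → M →h M' → shiftΛ c d M →h shiftΛ c d M'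
h-shift {c} {d} (hβ {P} {Q}) =
  subst (app (lam (shiftΛ (suc c) d P)) (shiftΛ c d Q) →h_) (sym (shift-subst-comm 0 c d Q P)) hβ
h-shift (hλ s) = hλ (h-shift s)
h-shift (happ {M = var _} _ ())
h-shift (happ {M = app _ _} _ s) = happ tt (h-shift s)

h-subst : ∀ {k N M M'} → M →h M' → substΛ k N M →h substΛ k N M'
h-subst {k} {N} (hβ {P} {Q}) =
  subst (app (lam (substΛ (suc k) N P)) (substΛ k N Q) →h_) (sym (subst-subst-comm 0 k N Q P)) hβ
h-subst (hλ s) = hλ (h-subst s)
h-subst (happ {M = var _} _ ())
h-subst (happ {M = app _ _} _ s) = happ tt (h-subst s)

β*-shift : ∀ {c d M M'} → M →β* M' → shiftΛ c d M →β* shiftΛ c d M'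
β*-shift = gmap _ β-shift

β*-subst : ∀ {k N M M'} → M →β* M' → substΛ k N M →β* substΛ k N M'
β*-subst = gmap _ β-subst

β*-lam : ∀ {M M'} → M →β* M' → lam M →β* lam M'
β*-lam = gmap lam ξλ

β*-appˡ : ∀ {M M' N} → M →β* M' → app M N →β* app M' N
β*-appˡ = gmap _ ξappˡ

-- Thus T_r(M) ⊆ {a ∣ a ⊑ M}, and unlike
-- T_r(M) the relation ⊑ is closed under rigid reduction of a.

mutual
  data _◁_ : RT → Λ → Set where
    var : ∀ {x} → var x ◁ var x
    lam : ∀ {a M} → a ⊑ M → lam a ◁ lam M
    app : ∀ {c ds P Q} → c ⊑ P → All (_⊑ Q) ds → app c ds ◁ app P Q

  data _⊑_ : RT → Λ → Set where
    red : ∀ {a M N} → M →β* N → a ◁ N → a ⊑ M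

⊑-expand : ∀ {a M M'} → M →β* M' → a ⊑ M' → a ⊑ M
⊑-expand M→M' (red M'→N a◁N) = red (M→M' ◅◅ M'→N) a◁N

mutual
  ∈Tr⇒⊑ : ∀ {a M} → a ∈Tr M → a ⊑ M
  ∈Tr⇒⊑ var          = red ε var
  ∈Tr⇒⊑ (lam a∈)     = red ε (lam (∈Tr⇒⊑ a∈))
  ∈Tr⇒⊑ (app c∈ ds∈) = red ε (app (∈Tr⇒⊑ c∈) (∈Tr⇒⊑-all ds∈))

  ∈Tr⇒⊑-all : ∀ {ds Q} → All (_∈Tr Q) ds → All (_⊑ Q) ds
  ∈Tr⇒⊑-all []         = []
  ∈Tr⇒⊑-all (d∈ ∷ ds∈) = ∈Tr⇒⊑ d∈ ∷ ∈Tr⇒⊑-all ds∈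

mutual
  shift-⊑ : ∀ {c d a M} → a ⊑ M → shiftR c d a ⊑ shiftΛ c d M
  shift-⊑ (red M→N a◁N) = red (β*-shift M→N) (shift-◁ a◁N)

  shift-◁ : ∀ {c d a M} → a ◁ M → shiftR c d a ◁ shiftΛ c d M
  shift-◁ {c} {d} (var {x}) with x <? c
  ... | yes x<c rewrite shiftR-< {c} {d} x<c | shiftΛ-< {c} {d} x<c = var
  ... | no x≮c  rewrite shiftR-≥ {c} {d} (≮⇒≥ x≮c) | shiftΛ-≥ {c} {d} (≮⇒≥ x≮c) = var
  shift-◁ (lam a⊑)      = lam (shift-⊑ a⊑)
  shift-◁ (app c⊑ ds⊑)  = app (shift-⊑ c⊑) (shift-⊑-all ds⊑)

  shift-⊑-all : ∀ {c d ds Q} → All (_⊑ Q) ds → All (_⊑ shiftΛ c d Q) (shiftRL c d ds)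
  shift-⊑-all []          = []
  shift-⊑-all (d⊑ ∷ ds⊑) = shift-⊑ d⊑ ∷ shift-⊑-all ds⊑

mutual
  rsub-⊑ : ∀ {k c P Q bs c' bs'} → c ⊑ P → All (_⊑ Q) bs → rsub k c bs ≡ just (c' , bs')
         → c' ⊑ substΛ k Q P × All (_⊑ Q) bs'
  rsub-⊑ (red P→N c◁N) bs⊑ eq with rsub-◁ c◁N bs⊑ eq
  ... | c'⊑ , bs'⊑ = ⊑-expand (β*-subst P→N) c'⊑ , bs'⊑

  rsub-◁ : ∀ {k c P Q bs c' bs'} → c ◁ P → All (_⊑ Q) bs → rsub k c bs ≡ just (c' , bs')
         → c' ⊑ substΛ k Q P × All (_⊑ Q) bs'
  rsub-◁ {k} {Q = Q} {bs} (var {x}) bs⊑ eq with <-cmp x k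
  ... | tri< x<k _ _ with trans (sym (rsubVar-< {k} {x} {bs} x<k)) eq
  ...   | refl rewrite substΛ-< {k} {Q} x<k = red ε var , bs⊑
  rsub-◁ {k} {bs = []} var bs⊑ eq | tri≈ _ refl _ with trans (sym (rsubVar-≡[] {k})) eq
  ... | ()
  rsub-◁ {k} {Q = Q} {b ∷ bs} var (b⊑ ∷ bs⊑) eq | tri≈ _ refl _
    with trans (sym (rsubVar-≡ {k} {b} {bs})) eq
  ... | refl rewrite substΛ-≡ {k} {Q} = shift-⊑ b⊑ , bs⊑
  rsub-◁ {k} {Q = Q} {bs} (var {x}) bs⊑ eq | tri> _ _ k<x with trans (sym (rsubVar-> {k} {x} {bs} k<x)) eq
  ... | refl rewrite substΛ-> {k} {Q} k<x = red ε var , bs⊑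
  rsub-◁ {k} {bs = bs} (lam {a} a⊑) bs⊑ eq with rsub (suc k) a bs in e
  ... | just (a' , bs'') with eq
  ...   | refl with rsub-⊑ a⊑ bs⊑ e
  ...     | a'⊑ , bs'⊑ = red ε (lam a'⊑) , bs'⊑
  rsub-◁ {k} {bs = bs} (app {c} {ds} c⊑ ds⊑) bs⊑ eq with rsub k c bs in e₁
  ... | just (c' , bs₁) with rsubL k ds bs₁ in e₂
  ...   | just (ds' , bs₂) with eq
  ...     | refl with rsub-⊑ c⊑ bs⊑ e₁
  ...       | c'⊑ , bs₁⊑ with rsub-⊑-all ds⊑ bs₁⊑ e₂
  ...         | ds'⊑ , bs₂⊑ = red ε (app c'⊑ ds'⊑) , bs₂⊑

  rsub-⊑-all : ∀ {k ds P Q bs ds' bs'} → All (_⊑ P) ds → All (_⊑ Q) bs → rsubL k ds bs ≡ just (ds' , bs')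
             → All (_⊑ substΛ k Q P) ds' × All (_⊑ Q) bs'
  rsub-⊑-all [] bs⊑ refl = [] , bs⊑
  rsub-⊑-all {k} {bs = bs} (_∷_ {d} {ds} d⊑ ds⊑) bs⊑ eq with rsub k d bs in e₁
  ... | just (d' , bs₁) with rsubL k ds bs₁ in e₂
  ...   | just (ds' , bs₂) with eq
  ...     | refl with rsub-⊑ d⊑ bs⊑ e₁
  ...       | d'⊑ , bs₁⊑ with rsub-⊑-all ds⊑ bs₁⊑ e₂
  ...         | ds'⊑ , bs₂⊑ = d'⊑ ∷ ds'⊑ , bs₂⊑

rsubst-just : ∀ {c ds a} → rsubst c ds ≡ just a → rsub 0 c ds ≡ just (a , [])
rsubst-just {c} {ds} eq with rsub 0 c ds
rsubst-just refl | just (_ , []) = refl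

mutual
  step-⊑ : ∀ {a M r a'} → a ⊑ M → a →r r → r ≡ just a' → a' ⊑ M
  step-⊑ (red M→N a◁N) st eq = ⊑-expand M→N (step-◁ a◁N st eq)

  step-◁ : ∀ {a N r a'} → a ◁ N → a →r r → r ≡ just a' → a' ⊑ N
  step-◁ (app (red P→N (lam c⊑)) ds⊑) (β {c} {ds}) eq =
    ⊑-expand (β*-appˡ P→N ◅◅ (β ◅ ε)) (proj₁ (rsub-⊑ c⊑ ds⊑ (rsubst-just {c} {ds} eq)))
  step-◁ (lam a⊑)     (ξλ {r = just _} st)     refl = red ε (lam (step-⊑ a⊑ st refl))
  step-◁ (app c⊑ ds⊑) (ξappˡ {r = just _} st)  refl = red ε (app (step-⊑ c⊑ st refl) ds⊑)
  step-◁ (app c⊑ ds⊑) (ξappʳ {rs = just _} st) refl = red ε (app c⊑ (step-⊑-all ds⊑ st refl))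

  step-⊑-all : ∀ {ds Q rs ds'} → All (_⊑ Q) ds → ds →rL rs → rs ≡ just ds' → All (_⊑ Q) ds'
  step-⊑-all (d⊑ ∷ ds⊑) (here {r = just _} st)   refl = step-⊑ d⊑ st refl ∷ ds⊑
  step-⊑-all (d⊑ ∷ ds⊑) (there {rs = just _} st) refl = d⊑ ∷ step-⊑-all ds⊑ st refl

reduct-⊑ : ∀ {a M b} → a ⊑ M → just a →r* just b → b ⊑ M
reduct-⊑ a⊑ refl = a⊑
reduct-⊑ a⊑ (step {r = just _} st rest) = reduct-⊑ (step-⊑ a⊑ st refl) rest
reduct-⊑ a⊑ (step {r = nothing} st ())

headVar-⊑ : ∀ {b M} → HeadVarR b → b ⊑ M → Σ Λ λ N → M →β* N × HeadVarΛ N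
headVar-⊑ var (red M→N var) = _ , M→N , var
headVar-⊑ (app hv) (red M→N (app c⊑ _)) with headVar-⊑ hv c⊑
... | P , P→ , hvP = app P _ , M→N ◅◅ β*-appˡ P→ , app hvP

hnf-⊑ : ∀ {b M} → IsHNFr b → b ⊑ M → Σ Λ λ N → M →β* N × IsHNF N
hnf-⊑ (head hv) b⊑ with headVar-⊑ hv b⊑
... | N , M→N , hvN = N , M→N , head hvN
hnf-⊑ (lam h) (red M→N (lam b⊑)) with hnf-⊑ h b⊑
... | N , M→ , hN = lam N , M→N ◅◅ β*-lam M→ , lam hN

RigidNormalizable : Λ → Set
RigidNormalizable M = Σ RT λ a → a ∈Tr M × Σ (Maybe RT) λ n → IsNF a n × n ≢ nothing

RigidHeadNormalizable : Λ → Set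
RigidHeadNormalizable M =
  Σ RT λ a → a ∈Tr M × Σ ℕ λ m → Σ RT λ b → (Hr ^[ m ] just a) ≡ just b × IsHNFr b

HeadReductionStops : Λ → Set
HeadReductionStops M = Σ ℕ λ m → IsHNF (H ^[ m ] M)

HeadNormalizable : Λ → Set
HeadNormalizable M = Σ Λ λ N → M →β* N × IsHNF N

-- A nonzero rigid term is either a head-normal form or has a rigid redex
-- (its head redex); hence nonzero normal rigid terms are head-normal.

headVar-or-step : ∀ c ds → IsHNFr (app c ds) ⊎ Σ (Maybe RT) λ r → app c ds →r r
headVar-or-step (var n)    ds = inj₁ (head (app var))
headVar-or-step (lam c)    ds = inj₂ (_ , β)
headVar-or-step (app c es) ds with headVar-or-step c es
... | inj₁ (head hv) = inj₁ (head (app hv))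
... | inj₂ (r , st)  = inj₂ (_ , ξappˡ st)

hnf-or-step : ∀ a → IsHNFr a ⊎ Σ (Maybe RT) λ r → a →r r
hnf-or-step (var n) = inj₁ (head var)
hnf-or-step (lam a) with hnf-or-step a
... | inj₁ h        = inj₁ (lam h)
... | inj₂ (r , st) = inj₂ (_ , ξλ st)
hnf-or-step (app c ds) = headVar-or-step c ds

normal⇒hnf : ∀ a → Normal (just a) → IsHNFr a
normal⇒hnf a nf with hnf-or-step a
... | inj₁ h        = h
... | inj₂ (r , st) = ⊥-elim (nf r st)

-- Head resource reduction is a (possibly empty) rigid reduction, so every
-- iterate H_r^m(a) is a rigid reduct of a.

_◅◅r_ : ∀ {r s t} → r →r* s → s →r* t → r →r* t
refl        ◅◅r t = t
step st r→s ◅◅r t = step st (r→s ◅◅r t)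

Hr₀-fixed-or-step : ∀ a → Hr₀ a ≡ just a ⊎ a →r Hr₀ a
Hr₀-fixed-or-step (var n) = inj₁ refl
Hr₀-fixed-or-step (lam a) with Hr₀-fixed-or-step a
... | inj₁ e  = inj₁ (cong (Maybe.map lam) e)
... | inj₂ st = inj₂ (ξλ st)
Hr₀-fixed-or-step (app (var n) ds) = inj₁ refl
Hr₀-fixed-or-step (app (lam c) ds) = inj₂ β
Hr₀-fixed-or-step (app (app c es) ds) with Hr₀-fixed-or-step (app c es)
... | inj₁ e  = inj₁ (cong (Maybe.map (λ c' → app c' ds)) e)
... | inj₂ st = inj₂ (ξappˡ st)

Hr-reduct : ∀ r → r →r* Hr r
Hr-reduct nothing = refl
Hr-reduct (just a) with Hr₀-fixed-or-step a
... | inj₁ e rewrite e = refl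
... | inj₂ st = step st refl

Hr^-reduct : ∀ m r → r →r* (Hr ^[ m ] r)
Hr^-reduct zero    r = refl
Hr^-reduct (suc m) r = Hr^-reduct m r ◅◅r Hr-reduct (Hr ^[ m ] r)

rigidNormalizable⇒headNormalizable : ∀ M → RigidNormalizable M → HeadNormalizable M
rigidNormalizable⇒headNormalizable M (a , a∈ , nothing , _ , n≢0) = ⊥-elim (n≢0 refl)
rigidNormalizable⇒headNormalizable M (a , a∈ , just n , (a→n , nf) , _) =
  hnf-⊑ (normal⇒hnf n nf) (reduct-⊑ (∈Tr⇒⊑ a∈) a→n)

rigidHeadNormalizable⇒headNormalizable : ∀ M → RigidHeadNormalizable M → HeadNormalizable M
rigidHeadNormalizable⇒headNormalizable M (a , a∈ , m , b , Hr^a≡b , hb) =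
  hnf-⊑ hb (reduct-⊑ (∈Tr⇒⊑ a∈) (subst (just a →r*_) Hr^a≡b (Hr^-reduct m (just a))))

mutual
  ∈Tr-shift⁻¹ : ∀ c k Q a → a ∈Tr shiftΛ c k Q → Σ RT λ d → d ∈Tr Q × a ≡ shiftR c k d
  ∈Tr-shift⁻¹ c k (var n) a a∈ with n <? c
  ... | yes n<c with subst (a ∈Tr_) (shiftΛ-< {c} {k} n<c) a∈
  ...   | var = var n , var , sym (shiftR-< n<c)
  ∈Tr-shift⁻¹ c k (var n) a a∈ | no n≮c with subst (a ∈Tr_) (shiftΛ-≥ {c} {k} (≮⇒≥ n≮c)) a∈
  ...   | var = var n , var , sym (shiftR-≥ (≮⇒≥ n≮c))
  ∈Tr-shift⁻¹ c k (lam Q) (lam a) (lam a∈) with ∈Tr-shift⁻¹ (suc c) k Q a a∈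
  ... | d , d∈ , refl = lam d , lam d∈ , refl
  ∈Tr-shift⁻¹ c k (app P Q) (app a ds) (app a∈ ds∈)
    with ∈Tr-shift⁻¹ c k P a a∈ | ∈Tr-shift⁻¹-all c k Q ds ds∈
  ... | d , d∈ , refl | es , es∈ , refl = app d es , app d∈ es∈ , refl

  ∈Tr-shift⁻¹-all : ∀ c k Q ds → All (_∈Tr shiftΛ c k Q) ds
                  → Σ (List RT) λ es → All (_∈Tr Q) es × ds ≡ shiftRL c k es
  ∈Tr-shift⁻¹-all c k Q [] [] = [] , [] , refl
  ∈Tr-shift⁻¹-all c k Q (d ∷ ds) (d∈ ∷ ds∈)
    with ∈Tr-shift⁻¹ c k Q d d∈ | ∈Tr-shift⁻¹-all c k Q ds ds∈
  ... | e , e∈ , refl | es , es∈ , refl = e ∷ es , e∈ ∷ es∈ , refl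

rsub-lam : ∀ {k c bs a' bs'} → rsub (suc k) c bs ≡ just (a' , bs')
         → rsub k (lam c) bs ≡ just (lam a' , bs')
rsub-lam e rewrite e = refl

rsub-app : ∀ {k c ds bs c' bs₁ ds' bs₂} → rsub k c bs ≡ just (c' , bs₁) → rsubL k ds bs₁ ≡ just (ds' , bs₂)
         → rsub k (app c ds) bs ≡ just (app c' ds' , bs₂)
rsub-app e₁ e₂ rewrite e₁ | e₂ = refl

rsubL-∷ : ∀ {k d ds bs d' bs₁ ds' bs₂} → rsub k d bs ≡ just (d' , bs₁) → rsubL k ds bs₁ ≡ just (ds' , bs₂)
        → rsubL k (d ∷ ds) bs ≡ just (d' ∷ ds' , bs₂)
rsubL-∷ e₁ e₂ rewrite e₁ | e₂ = refl

rsubst-complete : ∀ {c ds a} → rsub 0 c ds ≡ just (a , []) → rsubst c ds ≡ just a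
rsubst-complete e rewrite e = refl

-- a arises from P[Q/k] by rigid substitution: a = c[ds/k] for some c ∈ T_r(P)
-- and a list ds of elements of T_r(Q), consumed exactly (any further
-- arguments are passed through untouched).
SubstPreimage : ℕ → Λ → Λ → RT → Set
SubstPreimage k Q P a =
  Σ RT λ c → c ∈Tr P × Σ (List RT) λ ds → All (_∈Tr Q) ds
    × (∀ rest → rsub k c (ds ++ rest) ≡ just (a , rest))

SubstPreimages : ℕ → Λ → Λ → List RT → Set
SubstPreimages k Q P as =
  Σ (List RT) λ cs → All (_∈Tr P) cs × Σ (List RT) λ ds → All (_∈Tr Q) ds
    × (∀ rest → rsubL k cs (ds ++ rest) ≡ just (as , rest))

-- Anti-substitution: T_r(P[Q/k]) consists of rigid substitutions of
-- elements of T_r(Q) into elements of T_r(P).  The arguments of an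
-- application are the concatenation of those of its parts.
mutual
  ∈Tr-subst⁻¹ : ∀ k Q P a → a ∈Tr substΛ k Q P → SubstPreimage k Q P a
  ∈Tr-subst⁻¹ k Q (var n) a a∈ with <-cmp n k
  ... | tri< n<k _ _ with subst (a ∈Tr_) (substΛ-< {k} {Q} n<k) a∈
  ...   | var = var n , var , [] , [] , λ _ → rsubVar-< n<k
  ∈Tr-subst⁻¹ k Q (var n) a a∈ | tri≈ _ refl _
    with ∈Tr-shift⁻¹ 0 k Q a (subst (a ∈Tr_) (substΛ-≡ {k} {Q}) a∈)
  ...   | d , d∈ , refl = var k , var , d ∷ [] , d∈ ∷ [] , λ _ → rsubVar-≡
  ∈Tr-subst⁻¹ k Q (var n) a a∈ | tri> _ _ k<n with subst (a ∈Tr_) (substΛ-> {k} {Q} k<n) a∈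
  ...   | var = var n , var , [] , [] , λ _ → rsubVar-> k<n
  ∈Tr-subst⁻¹ k Q (lam P) (lam a) (lam a∈) with ∈Tr-subst⁻¹ (suc k) Q P a a∈
  ... | c , c∈ , ds , ds∈ , f = lam c , lam c∈ , ds , ds∈ , λ rest → rsub-lam {k} {c} (f rest)
  ∈Tr-subst⁻¹ k Q (app P P') (app a as) (app a∈ as∈)
    with ∈Tr-subst⁻¹ k Q P a a∈ | ∈Tr-subst⁻¹-all k Q P' as as∈
  ... | c , c∈ , ds , ds∈ , f | cs , cs∈ , es , es∈ , g =
    app c cs , app c∈ cs∈ , ds ++ es , All.++⁺ ds∈ es∈ ,
    λ rest → subst (λ bs → rsub k (app c cs) bs ≡ just (app a as , rest)) (sym (List.++-assoc ds es rest))
                   (rsub-app {k} {c} {cs} (f (es ++ rest)) (g rest))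

  ∈Tr-subst⁻¹-all : ∀ k Q P as → All (_∈Tr substΛ k Q P) as → SubstPreimages k Q P as
  ∈Tr-subst⁻¹-all k Q P [] [] = [] , [] , [] , [] , λ _ → refl
  ∈Tr-subst⁻¹-all k Q P (a ∷ as) (a∈ ∷ as∈)
    with ∈Tr-subst⁻¹ k Q P a a∈ | ∈Tr-subst⁻¹-all k Q P as as∈
  ... | c , c∈ , ds , ds∈ , f | cs , cs∈ , es , es∈ , g =
    c ∷ cs , c∈ ∷ cs∈ , ds ++ es , All.++⁺ ds∈ es∈ ,
    λ rest → subst (λ bs → rsubL k (c ∷ cs) bs ≡ just (a ∷ as , rest)) (sym (List.++-assoc ds es rest))
                   (rsubL-∷ {k} {c} {cs} (f (es ++ rest)) (g rest))

-- Every element of T_r(H M) is H_r of an element of T_r(M): at the head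
-- redex this is anti-substitution, elsewhere H and H_r follow the same path.
∈Tr-H⁻¹ : ∀ M b → b ∈Tr H M → Σ RT λ a → a ∈Tr M × Hr₀ a ≡ just b
∈Tr-H⁻¹ (var n) .(var n) var = var n , var , refl
∈Tr-H⁻¹ (lam M) (lam b) (lam b∈) with ∈Tr-H⁻¹ M b b∈
... | a , a∈ , e = lam a , lam a∈ , cong (Maybe.map lam) e
∈Tr-H⁻¹ (app (lam P) Q) b b∈ with ∈Tr-subst⁻¹ 0 Q P b b∈
... | c , c∈ , ds , ds∈ , f =
  app (lam c) ds , app (lam c∈) ds∈ ,
  rsubst-complete {c} {ds} (subst (λ bs → rsub 0 c bs ≡ just (b , [])) (List.++-identityʳ ds) (f []))
∈Tr-H⁻¹ (app (var n) Q) (app .(var n) ds) (app var ds∈) = app (var n) ds , app var ds∈ , refl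
∈Tr-H⁻¹ (app (app M N) Q) (app c ds) (app c∈ ds∈) with ∈Tr-H⁻¹ (app M N) c c∈
... | app c₀ es , app c₀∈ es∈ , e =
  app (app c₀ es) ds , app (app c₀∈ es∈) ds∈ , cong (Maybe.map (λ c' → app c' ds)) e

∈Tr-H^⁻¹ : ∀ m M b → b ∈Tr (H ^[ m ] M) → Σ RT λ a → a ∈Tr M × (Hr ^[ m ] just a) ≡ just b
∈Tr-H^⁻¹ zero    M b b∈ = b , b∈ , refl
∈Tr-H^⁻¹ (suc m) M b b∈ with ∈Tr-H⁻¹ (H ^[ m ] M) b b∈
... | a₁ , a₁∈ , Hr₀a₁≡b with ∈Tr-H^⁻¹ m M a₁ a₁∈
...   | a , a∈ , Hr^a≡a₁ = a , a∈ , trans (cong Hr Hr^a≡a₁) Hr₀a₁≡b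

-- Completeness, step 2: thin head-normal forms, in which every argument
-- list is empty.  They are rigid-normal and every head-normal λ-term has
-- one in its expansion.

data ThinHeadVar : RT → Set where
  var : ∀ {n} → ThinHeadVar (var n)
  app : ∀ {c} → ThinHeadVar c → ThinHeadVar (app c [])

data ThinHNF : RT → Set where
  head : ∀ {a} → ThinHeadVar a → ThinHNF a
  lam  : ∀ {a} → ThinHNF a → ThinHNF (lam a)

thinHeadVar-normal : ∀ {a r} → ThinHeadVar a → ¬ (a →r r)
thinHeadVar-normal var ()
thinHeadVar-normal (app ()) β
thinHeadVar-normal (app t) (ξappˡ st) = thinHeadVar-normal t st
thinHeadVar-normal (app t) (ξappʳ ())

thinHNF-normal : ∀ {a r} → ThinHNF a → ¬ (a →r r)
thinHNF-normal (head t) st      = thinHeadVar-normal t st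
thinHNF-normal (lam t) (ξλ st) = thinHNF-normal t st

thinHeadVar-headVar : ∀ {a} → ThinHeadVar a → HeadVarR a
thinHeadVar-headVar var     = var
thinHeadVar-headVar (app t) = app (thinHeadVar-headVar t)

thinHNF-hnf : ∀ {a} → ThinHNF a → IsHNFr a
thinHNF-hnf (head t) = head (thinHeadVar-headVar t)
thinHNF-hnf (lam t)  = lam (thinHNF-hnf t)

thin-headVar : ∀ {M} → HeadVarΛ M → Σ RT λ a → a ∈Tr M × ThinHeadVar a
thin-headVar var = _ , var , var
thin-headVar (app hv) with thin-headVar hv
... | a , a∈ , t = app a [] , app a∈ [] , app t

thin-hnf : ∀ {M} → IsHNF M → Σ RT λ a → a ∈Tr M × ThinHNF a
thin-hnf (head hv) with thin-headVar hv
... | a , a∈ , t = a , a∈ , head t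
thin-hnf (lam h) with thin-hnf h
... | a , a∈ , t = lam a , lam a∈ , lam t

headReductionStops⇒thin : ∀ M → HeadReductionStops M
  → Σ RT λ a → a ∈Tr M × Σ ℕ λ m → Σ RT λ b → (Hr ^[ m ] just a) ≡ just b × ThinHNF b
headReductionStops⇒thin M (m , hnf) with thin-hnf hnf
... | b , b∈ , t with ∈Tr-H^⁻¹ m M b b∈
...   | a , a∈ , Hr^a≡b = a , a∈ , m , b , Hr^a≡b , t

headReductionStops⇒rigidHeadNormalizable : ∀ M → HeadReductionStops M → RigidHeadNormalizable M
headReductionStops⇒rigidHeadNormalizable M stops with headReductionStops⇒thin M stops
... | a , a∈ , m , b , Hr^a≡b , t = a , a∈ , m , b , Hr^a≡b , thinHNF-hnf t

headReductionStops⇒rigidNormalizable : ∀ M → HeadReductionStops M → RigidNormalizable M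
headReductionStops⇒rigidNormalizable M stops with headReductionStops⇒thin M stops
... | a , a∈ , m , b , Hr^a≡b , t =
  a , a∈ , just b , (subst (just a →r*_) Hr^a≡b (Hr^-reduct m (just a)) , λ _ → thinHNF-normal t) , λ ()

-- Every β-step is a ⇛-step, and ⇛ followed by a head step can
-- be rearranged into head steps followed by ⇛, so head-normalisability by β
-- implies head-normalisability by head reduction.

data _⇛_ : Λ → Λ → Set where
  head : ∀ {M M₁ N} → M →h M₁ → M₁ ⇛ N → M ⇛ N
  var  : ∀ {n} → var n ⇛ var n
  lam  : ∀ {M N} → M ⇛ N → lam M ⇛ lam N
  app  : ∀ {M M' N N'} → M ⇛ M' → N ⇛ N' → app M N ⇛ app M' N'

-- Head steps from a term that is not an abstraction; these are exactly the
-- head steps that lift through the function part of an application.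
_→a_ : Λ → Λ → Set
M →a N = NotLam M × M →h N

_→a*_ : Λ → Λ → Set
_→a*_ = Star _→a_

→a*⇒→h* : ∀ {M M'} → M →a* M' → M →h* M'
→a*⇒→h* = gmap _ proj₂

→a*-appˡ : ∀ {M M' N} → M →a* M' → app M N →a* app M' N
→a*-appˡ = gmap _ (λ (¬lam , st) → tt , happ ¬lam st)

→h*-lam : ∀ {M M'} → M →h* M' → lam M →h* lam M'
→h*-lam = gmap lam hλ

⇛-refl : ∀ M → M ⇛ M
⇛-refl (var n)   = var
⇛-refl (lam M)   = lam (⇛-refl M)
⇛-refl (app M N) = app (⇛-refl M) (⇛-refl N)

β⇒⇛ : ∀ {M N} → M →β N → M ⇛ N
β⇒⇛ β         = head hβ (⇛-refl _)
β⇒⇛ (ξλ s)    = lam (β⇒⇛ s)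
β⇒⇛ (ξappˡ s) = app (β⇒⇛ s) (⇛-refl _)
β⇒⇛ (ξappʳ s) = app (⇛-refl _) (β⇒⇛ s)

⇛-shift : ∀ {c d M N} → M ⇛ N → shiftΛ c d M ⇛ shiftΛ c d N
⇛-shift (head st M₁⇛N) = head (h-shift st) (⇛-shift M₁⇛N)
⇛-shift {c} {d} (var {n}) = ⇛-refl (shiftΛ c d (var n))
⇛-shift (lam M⇛N)   = lam (⇛-shift M⇛N)
⇛-shift (app M⇛ N⇛) = app (⇛-shift M⇛) (⇛-shift N⇛)

⇛-subst : ∀ {k P P' Q Q'} → P ⇛ P' → Q ⇛ Q' → substΛ k Q P ⇛ substΛ k Q' P'
⇛-subst (head st P₁⇛P') Q⇛ = head (h-subst st) (⇛-subst P₁⇛P' Q⇛)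
⇛-subst {k} {Q = Q} {Q' = Q'} (var {n}) Q⇛ with <-cmp n k
... | tri< n<k _ _ rewrite substΛ-< {k} {Q} n<k | substΛ-< {k} {Q'} n<k = var
... | tri≈ _ refl _ rewrite substΛ-≡ {k} {Q} | substΛ-≡ {k} {Q'} = ⇛-shift Q⇛
... | tri> _ _ k<n rewrite substΛ-> {k} {Q} k<n | substΛ-> {k} {Q'} k<n = var
⇛-subst (lam P⇛) Q⇛      = lam (⇛-subst P⇛ Q⇛)
⇛-subst (app P⇛ P'⇛) Q⇛ = app (⇛-subst P⇛ Q⇛) (⇛-subst P'⇛ Q⇛)

⇛-notLam : ∀ {M N} → M ⇛ N → NotLam N → NotLam M
⇛-notLam (head {M = var _} () _) _
⇛-notLam (head {M = lam _} (hλ _) M₁⇛N) ¬lam = ⇛-notLam M₁⇛N ¬lam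
⇛-notLam (head {M = app _ _} _ _) _ = tt
⇛-notLam var _ = tt
⇛-notLam (app _ _) _ = tt

⇛-lam⁻¹ : ∀ {M P} → M ⇛ lam P → Σ Λ λ Y → M →a* lam Y × Y ⇛ P
⇛-lam⁻¹ (head {M = var _} () _)
⇛-lam⁻¹ (head {M = lam X} (hλ st) M₁⇛) with ⇛-lam⁻¹ M₁⇛
... | Y , ε , Y⇛ = X , ε , head st Y⇛
... | Y , (() , _) ◅ _ , _
⇛-lam⁻¹ (head {M = app _ _} st M₁⇛) with ⇛-lam⁻¹ M₁⇛
... | Y , M₁→ , Y⇛ = Y , (tt , st) ◅ M₁→ , Y⇛
⇛-lam⁻¹ (lam {M = M} M⇛) = M , ε , M⇛

⇛-h-commute : ∀ {M N N₁} → M ⇛ N → N →h N₁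
            → Σ Λ λ M' → M →h* M' × (NotLam N → M →a* M') × M' ⇛ N₁
⇛-h-commute (head st M₁⇛) t with ⇛-h-commute M₁⇛ t
... | M' , M₁→ , M₁→a , M'⇛ =
  M' , st ◅ M₁→ , (λ ¬lam → (⇛-notLam (head st M₁⇛) ¬lam , st) ◅ M₁→a ¬lam) , M'⇛
⇛-h-commute var ()
⇛-h-commute (lam M⇛) (hλ t) with ⇛-h-commute M⇛ t
... | M' , M→ , _ , M'⇛ = lam M' , →h*-lam M→ , (λ ()) , lam M'⇛
⇛-h-commute (app {N = Q} M⇛ Q⇛) hβ with ⇛-lam⁻¹ M⇛
... | Y , M→ , Y⇛ =
  Y [ Q /0] , →a*⇒→h* (→a*-appˡ M→) ◅◅ (hβ ◅ ε) , (λ _ → →a*-appˡ M→ ◅◅ ((tt , hβ) ◅ ε)) , ⇛-subst Y⇛ Q⇛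
⇛-h-commute (app {N = Q} M⇛ Q⇛) (happ ¬lam t) with ⇛-h-commute M⇛ t
... | M' , _ , M→a , M'⇛ = app M' Q , →a*⇒→h* (→a*-appˡ (M→a ¬lam)) , (λ _ → →a*-appˡ (M→a ¬lam)) , app M'⇛ Q⇛

headVar-notLam : ∀ {M} → HeadVarΛ M → NotLam M
headVar-notLam var     = tt
headVar-notLam (app _) = tt

⇛-headVar : ∀ {M N} → M ⇛ N → HeadVarΛ N → Σ Λ λ L → M →a* L × HeadVarΛ L
⇛-headVar (head st M₁⇛) hv with ⇛-headVar M₁⇛ hv
... | L , M₁→ , hvL = L , (⇛-notLam (head st M₁⇛) (headVar-notLam hv) , st) ◅ M₁→ , hvL
⇛-headVar var var = _ , ε , var
⇛-headVar (app {N = Q} M⇛ _) (app hv) with ⇛-headVar M⇛ hv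
... | L , M→ , hvL = app L Q , →a*-appˡ M→ , app hvL

⇛-hnf : ∀ {M N} → M ⇛ N → IsHNF N → Σ Λ λ L → M →h* L × IsHNF L
⇛-hnf (head st M₁⇛) h with ⇛-hnf M₁⇛ h
... | L , M₁→ , hL = L , st ◅ M₁→ , hL
⇛-hnf var h = _ , ε , h
⇛-hnf (lam M⇛) (lam h) with ⇛-hnf M⇛ h
... | L , M→ , hL = lam L , →h*-lam M→ , lam hL
⇛-hnf M⇛@(app _ _) (head hv) with ⇛-headVar M⇛ hv
... | L , M→ , hvL = L , →a*⇒→h* M→ , head hvL

⇛-h*-hnf : ∀ {M N L} → M ⇛ N → N →h* L → IsHNF L → Σ Λ λ L' → M →h* L' × IsHNF L'
⇛-h*-hnf M⇛ ε h = ⇛-hnf M⇛ h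
⇛-h*-hnf M⇛ (t ◅ ts) h with ⇛-h-commute M⇛ t
... | M' , M→ , _ , M'⇛ with ⇛-h*-hnf M'⇛ ts h
...   | L' , M'→ , hL' = L' , M→ ◅◅ M'→ , hL'

β*-hnf⇒h*-hnf : ∀ {M N} → M →β* N → IsHNF N → Σ Λ λ L → M →h* L × IsHNF L
β*-hnf⇒h*-hnf ε h = _ , ε , h
β*-hnf⇒h*-hnf (s ◅ ss) h with β*-hnf⇒h*-hnf ss h
... | L , M→ , hL = ⇛-h*-hnf (β⇒⇛ s) M→ hL

h⇒H : ∀ {M M'} → M →h M' → H M ≡ M'
h⇒H hβ        = refl
h⇒H (hλ st)   = cong lam (h⇒H st)
h⇒H (happ {M = var _} _ ())
h⇒H (happ {M = app _ _} {N = N} _ st) = cong (λ X → app X N) (h⇒H st)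

H^-suc : ∀ m M → H ^[ suc m ] M ≡ H ^[ m ] (H M)
H^-suc zero    M = refl
H^-suc (suc m) M = cong H (H^-suc m M)

h*⇒H^ : ∀ {M L} → M →h* L → Σ ℕ λ m → H ^[ m ] M ≡ L
h*⇒H^ ε = zero , refl
h*⇒H^ {M} (st ◅ sts) with h*⇒H^ sts
... | m , H^M'≡L = suc m , trans (H^-suc m M) (trans (cong (H ^[ m ]_) (h⇒H st)) H^M'≡L)

headNormalizable⇒headReductionStops : ∀ M → HeadNormalizable M → HeadReductionStops M
headNormalizable⇒headReductionStops M (N , M→N , hN) with β*-hnf⇒h*-hnf M→N hN
... | L , M→L , hL with h*⇒H^ M→L
...   | m , H^M≡L = m , subst IsHNF (sym H^M≡L) hL

H-β* : ∀ M → M →β* H M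
H-β* (var n)           = ε
H-β* (lam M)           = β*-lam (H-β* M)
H-β* (app (var n) Q)   = ε
H-β* (app (lam P) Q)   = β ◅ ε
H-β* (app (app M N) Q) = β*-appˡ (H-β* (app M N))

H^-β* : ∀ m M → M →β* (H ^[ m ] M)
H^-β* zero    M = ε
H^-β* (suc m) M = H^-β* m M ◅◅ H-β* (H ^[ m ] M)

headReductionStops⇒headNormalizable : ∀ M → HeadReductionStops M → HeadNormalizable M
headReductionStops⇒headNormalizable M (m , hnf) = H ^[ m ] M , H^-β* m M , hnf

mainTheorem1 : (M : Λ) →
    ((Σ RT λ a → a ∈Tr M × Σ (Maybe RT) λ n → IsNF a n × n ≢ nothing)
    ⇔ (Σ RT λ a → a ∈Tr M × Σ ℕ λ m → Σ RT λ b → (Hr ^[ m ] just a) ≡ just b × IsHNFr b))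
    × ((Σ RT λ a → a ∈Tr M × Σ ℕ λ m → Σ RT λ b → (Hr ^[ m ] just a) ≡ just b × IsHNFr b)
    ⇔ (Σ ℕ λ m → IsHNF (H ^[ m ] M)))
    × ((Σ ℕ λ m → IsHNF (H ^[ m ] M))
    ⇔ (Σ Λ λ N → M →β* N × IsHNF N))
mainTheorem1 M =
    mk⇔ (iii⇒ii ∘ i⇒iii) (iii⇒i ∘ ii⇒iii)
  , mk⇔ ii⇒iii iii⇒ii
  , mk⇔ iii⇒iv iv⇒iii
  where
  iii⇒iv : HeadReductionStops M → HeadNormalizable M
  iii⇒iv = headReductionStops⇒headNormalizable M

  iv⇒iii : HeadNormalizable M → HeadReductionStops M
  iv⇒iii = headNormalizable⇒headReductionStops M

  iii⇒i : HeadReductionStops M → RigidNormalizable M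
  iii⇒i = headReductionStops⇒rigidNormalizable M

  iii⇒ii : HeadReductionStops M → RigidHeadNormalizable M
  iii⇒ii = headReductionStops⇒rigidHeadNormalizable M

  i⇒iii : RigidNormalizable M → HeadReductionStops M
  i⇒iii = iv⇒iii ∘ rigidNormalizable⇒headNormalizable M

  ii⇒iii : RigidHeadNormalizable M → HeadReductionStops M
  ii⇒iii = iv⇒iii ∘ rigidHeadNormalizable⇒headNormalizable M
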